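{- Let $S_{2fix}$ be the rank $23$ decomposition of $M_{\langle 3\rangle}$ described in the context. Then its symmetry group $\Gamma_{S_{2fix}}$ is the cyclic group $\mathbb Z_3$ generated by the cyclic permutation $\sigma$.
   Context: $\mathrm{Mat}_3$ is the space of complex $3\times 3$ matrices; $x\otimes y\otimes z\in\mathrm{Mat}_3^{\otimes 3}$ is identified with the trilinear form $(X,Y,Z)\mapsto(\sum x_{ij}X_{ij})(\sum y_{ij}Y_{ij})(\sum z_{ij}Z_{ij})$. The matrix multiplication tensor is $M_{\langle 3\rangle}=\sum_{i,j,k}E_{ij}\otimes E_{jk}\otimes E_{ki}$, $E_{ij}$ the matrix units. Let $G$ be the group of linear automorphisms of $\mathrm{Mat}_3^{\otimes 3}$ generated by: (i) for $(g,h,k)\in GL_3^{\times 3}$, $x\otimes y\otimes z\mapsto gxh^{ -1}\otimes hyk^{ -1}\otimes kzg^{ -1}$ (depending only on the image in $PGL_3^{\times 3}$); (ii) $\sigma:x\otimes y\otimes z\mapsto y\otimes z\otimes x$; (iii) $\tau:x\otimes y\otimes z\mapsto x^T\otimes z^T\otimes y^T$. $G\cong[(PGL_3^{\times 3})\rtimes\mathbb Z_3]\rtimes\mathbb Z_2$ is the symmetry group of $M_{\langle 3\rangle}$. For a decomposition $S$ (the set of its rank one summands), the symmetry group is $\Gamma_S=\{\gamma\in G:\{\gamma(t):t\in S\}=S\}$. $S_{2fix}$ is the set of $23$ rank one tensors (summing to $M_{\langle 3\rangle}$): (a) the cubes $m\otimes m\otimes m$ for $m\in\{\begin{pmatrix}1&0&0\\0&0&1\\0&0&1\end{pmatrix},\begin{pmatrix}0&0&0\\0&1&-1\\0&0&0\end{pmatrix}\}$;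 (b) for each triple $(p,q,r)$ below, the tensors $p\otimes q\otimes r$, $q\otimes r\otimes p$, $r\otimes p\otimes q$: $\left(\begin{pmatrix}0&1&0\\0&0&1\\0&0&0\end{pmatrix},\begin{pmatrix}0&0&0\\0&1&-1\\0&1&-1\end{pmatrix},\begin{pmatrix}0&0&0\\1&0&-1\\0&0&0\end{pmatrix}\right)$; $\left(\begin{pmatrix}0&-1&1\\0&0&0\\0&0&0\end{pmatrix},E_{33},E_{31}\right)$; $\left(\begin{pmatrix}1&0&0\\1&0&0\\0&0&0\end{pmatrix},\begin{pmatrix}0&-1&1\\0&0&0\\0&0&0\end{pmatrix},E_{32}\right)$; $\left(\begin{pmatrix}1&0&0\\0&0&1\\0&0&0\end{pmatrix},\begin{pmatrix}0&1&0\\0&0&1\\0&0&1\end{pmatrix},\begin{pmatrix}0&0&0\\1&0&-1\\0&1&-1\end{pmatrix}\right)$; $\left(E_{11},\begin{pmatrix}0&0&1\\0&0&1\\0&0&1\end{pmatrix},\begin{pmatrix}0&0&0\\0&0&0\\1&-1&0\end{pmatrix}\right)$; $\left(E_{23},\begin{pmatrix}0&1&0\\0&1&0\\0&1&0\end{pmatrix},\begin{pmatrix}0&0&0\\-1&1&0\\0&0&0\end{pmatrix}\right)$; $\left(\begin{pmatrix}0&0&0\\0&0&1\\0&0&1\end{pmatrix},\begin{pmatrix}1&0&0\\1&0&0\\1&0&0\end{pmatrix},\begin{pmatrix}-1&1&0\\0&0&0\\0&0&0\end{pmatrix}\right)$. -}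

module Defs where

open import Level using (Level; _⊔_)
open import Algebra.Bundles using (CommutativeRing)
open import Data.Nat as ℕ using (ℕ)
open import Data.Fin using (Fin; zero; suc)
open import Data.Bool using (Bool; true; false)
open import Data.Product using (Σ; ∃; _×_; _,_)
open import Data.Vec using (Vec; []; _∷_; lookup)
open import Relation.Nullary using (¬_)

module RingHelpers {c ℓ : Level} (R : CommutativeRing c ℓ) where
  open CommutativeRing R using (Carrier; _≈_; _+_; _*_; -_; 0#; 1#)

  natR : ℕ → Carrier
  natR ℕ.zero    = 0#
  natR (ℕ.suc n) = 1# + natR n

  -- value at x of the monic polynomial
  --   x^(n+1) + a₀ x^n + a₁ x^(n-1) + ... + aₙ
  -- given the coefficient vector (a₀ , … , aₙ)   (Horner scheme)
  hornerFrom : ∀ {n} → Carrier → Vec Carrier n → Carrier → Carrier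
  hornerFrom acc []       x = acc
  hornerFrom acc (a ∷ as) x = hornerFrom (acc * x + a) as x

  monicEval : ∀ {n} → Vec Carrier n → Carrier → Carrier
  monicEval as x = hornerFrom 1# as x

record ACF0 (c ℓ : Level) : Set (Level.suc (c ⊔ ℓ)) where
  field
    cring : CommutativeRing c ℓ
  open CommutativeRing cring
  open RingHelpers cring
  field
    nontrivial : ¬ (1# ≈ 0#)
    inverse    : ∀ x → ¬ (x ≈ 0#) → ∃ λ y → x * y ≈ 1#
    char0      : ∀ n → ¬ (natR (ℕ.suc n) ≈ 0#)
    algClosed  : ∀ n (as : Vec Carrier (ℕ.suc n)) → ∃ λ x → monicEval as x ≈ 0#

module Over {c ℓ : Level} (R : CommutativeRing c ℓ) where
  open CommutativeRing R using (Carrier; _≈_; _+_; _*_; -_; 0#; 1#)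

  Mat : Set c
  Mat = Fin 3 → Fin 3 → Carrier

  _·_ : Mat → Mat → Mat
  (A · B) i j = A i zero * B zero j + (A i (suc zero) * B (suc zero) j
                                    + A i (suc (suc zero)) * B (suc (suc zero)) j)

  idM : Mat
  idM i j with i Data.Fin.≟ j
  ... | Relation.Nullary.yes _ = 1#
  ... | Relation.Nullary.no _  = 0#

  _ᵀ : Mat → Mat
  (A ᵀ) i j = A j i

  _≈M_ : Mat → Mat → Set ℓ
  A ≈M B = ∀ i j → A i j ≈ B i j

  record GL : Set (c ⊔ ℓ) where
    field
      mat     : Mat
      inv     : Mat
      inv-r   : (mat · inv) ≈M idM
      inv-l   : (inv · mat) ≈M idM

  -- a rank-one tensor x ⊗ y ⊗ z is represented by the triple (x , y , z)
  Triple : Set c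
  Triple = Mat × Mat × Mat

  Tensor : Set c
  Tensor = Fin 3 → Fin 3 → Fin 3 → Fin 3 → Fin 3 → Fin 3 → Carrier

  ⟦_⟧ : Triple → Tensor
  ⟦ x , y , z ⟧ a b d e f g = x a b * y d e * z f g

  _≈T_ : Tensor → Tensor → Set ℓ
  S ≈T T = ∀ a b d e f g → S a b d e f g ≈ T a b d e f g

  sandwich : GL → GL → GL → Triple → Triple
  sandwich g h k (x , y , z) =
    ( (GL.mat g · x) · GL.inv h
    , ((GL.mat h · y) · GL.inv k
    , (GL.mat k · z) · GL.inv g))

  σ : Triple → Triple
  σ (x , y , z) = (y , z , x)

  τ : Triple → Triple
  τ (x , y , z) = (x ᵀ , z ᵀ , y ᵀ)

  σ^ : Fin 3 → Triple → Triple
  σ^ zero t             = t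
  σ^ (suc zero) t       = σ t
  σ^ (suc (suc zero)) t = σ (σ t)

  τ^ : Bool → Triple → Triple
  τ^ false t = t
  τ^ true  t = τ t

  -- Every element of G = [(PGL₃^{×3}) ⋊ ℤ₃] ⋊ ℤ₂ (the group generated by
  -- (i),(ii),(iii)) is of the form τ^b ∘ σ^a ∘ (g,h,k).
  record Elem : Set (c ⊔ ℓ) where
    constructor elem
    field
      g h k : GL
      a     : Fin 3
      b     : Bool

  -- action of an element of G on rank-one tensors (it is linear, and the
  -- rank-one tensors span Mat₃^{⊗3}, so this determines the element)
  act : Elem → Triple → Triple
  act (elem g h k a b) t = τ^ b (σ^ a (sandwich g h k t))

  _≈G_ : (Triple → Triple) → (Triple → Triple) → Set (c ⊔ ℓ)
  φ ≈G ψ = ∀ t → ⟦ φ t ⟧ ≈T ⟦ ψ t ⟧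

  PreservesDecomp : ∀ {r} → (Fin r → Triple) → Elem → Set ℓ
  PreservesDecomp {r} S γ =
      (∀ i → ∃ λ j → ⟦ act γ (S i) ⟧ ≈T ⟦ S j ⟧)
    × (∀ j → ∃ λ i → ⟦ act γ (S i) ⟧ ≈T ⟦ S j ⟧)

  data E : Set where
    O P N : E

  e : E → Carrier
  e O = 0#
  e P = 1#
  e N = - 1#

  M : E → E → E → E → E → E → E → E → E → Mat
  M a₁ a₂ a₃ b₁ b₂ b₃ c₁ c₂ c₃ i j =
    e (lookup (lookup ((a₁ ∷ a₂ ∷ a₃ ∷ []) ∷ (b₁ ∷ b₂ ∷ b₃ ∷ [])
                        ∷ (c₁ ∷ c₂ ∷ c₃ ∷ []) ∷ []) i) j)

  cube : Mat → Vec Triple 1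
  cube m = (m , m , m) ∷ []

  cyc : Mat → Mat → Mat → Vec Triple 3
  cyc p q r = (p , q , r) ∷ (q , r , p) ∷ (r , p , q) ∷ []

  open Data.Vec using (_++_)

  S2fixVec : Vec Triple 23
  S2fixVec =
       cube (M P O O
               O O P
               O O P)
    ++ cube (M O O O
               O P N
               O O O)
    ++ cyc (M O P O
              O O P
              O O O)
           (M O O O
              O P N
              O P N)
           (M O O O
              P O N
              O O O)
    ++ cyc (M O N P
              O O O
              O O O)
           (M O O O
              O O O
              O O P)
           (M O O O
              O O O
              P O O)
    ++ cyc (M P O O
              P O O
              O O O)
           (M O N P
              O O O
              O O O)
           (M O O O
              O O O
              O P O)
    ++ cyc (M P O O
              O O P
              O O O)
           (M O P O
              O O P
              O O P)
           (M O O O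
              P O N
              O P N)
    ++ cyc (M P O O
              O O O
              O O O)
           (M O O P
              O O P
              O O P)
           (M O O O
              O O O
              P N O)
    ++ cyc (M O O O
              O O P
              O O O)
           (M O P O
              O P O
              O P O)
           (M O O O
              N P O
              O O O)
    ++ cyc (M O O O
              O O P
              O O P)
           (M P O O
              P O O
              P O O)
           (M N P O
              O O O
              O O O)

  S2fix : Fin 23 → Triple
  S2fix i = lookup S2fixVec i

  InΓ : Elem → Set ℓ
  InΓ = PreservesDecomp S2fix

module Submission where

open import Defs
open import Algebra.Bundles using (RawRing)
import Algebra.Properties.Ring
import Algebra.Solver.Ring
import Algebra.Solver.Ring.AlmostCommutativeRing as ACR
open import Data.Bool using (Bool; true; false; if_then_else_)
import Data.Bool.Properties as Bool
open import Data.Empty using (⊥-elim)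
open import Data.Fin using (Fin; zero; suc; #_)
open import Data.Fin.Properties using (all?; any?; _≟_)
open import Data.Maybe using (Maybe; nothing; just; _>>=_)
import Data.Maybe.Properties as Maybe
open import Data.Nat as ℕ using (ℕ)
open import Data.Product using (Σ; ∃; _×_; _,_; proj₁; proj₂)
open import Data.Product.Properties using (≡-dec)
open import Data.Sum using (_⊎_; inj₁; inj₂; [_,_])
open import Data.Vec using (Vec; []; _∷_; _++_; lookup)
open import Data.Vec.Properties using (lookup-map)
open import Function using (_⇔_; mk⇔)
open import Function.Construct.Composition using (_⇔-∘_)
open import Function.Construct.Symmetry using (⇔-sym)
open import Level using (_⊔_)
open import Relation.Binary.PropositionalEquality as ≡ using (_≡_; _≢_)
open import Relation.Nullary using (Dec; yes; no; does; ¬_)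
open import Relation.Nullary.Decidable using (¬?; from-yes; _×-dec_; _⊎-dec_; _→-dec_; does-⇔)

-- Every γ ∈ G has the form τᵇ σᵃ (g, h, k).  Powers of σ lie in Γ since σ
-- permutes the 23 summands.  Conversely let γ ∈ Γ.  Peeling σᵃ τᵇ off γ,
-- the sandwich (g, h, k) sends every summand Sᵢ to some τᵇ Sⱼ.  A sandwich
-- preserves the rank of each factor, and S₂ = (p,q,r), S₃ = (q,r,p),
-- S₄ = (r,p,q) are the only summands with their rank profiles; so (g, h, k)
-- fixes them (b = 0) or sends them to τS₂, τS₄, τS₃ (b = 1).  Comparing
-- factors gives linear equations  k · g x = x' h  whose entries force g, h,
-- k to be scalar when b = 0, whence γ = σᵃ, and to be multiples of one fixed
-- matrix n when b = 1, which is impossible because S₅ then has no image.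

module Proof {c ℓ} (F : ACF0 c ℓ) where
  open ACF0 F using (cring; nontrivial; char0)
  open Algebra.Bundles.CommutativeRing cring hiding (zero)
  open Over cring
  open RingHelpers cring using (natR)
  open Algebra.Properties.Ring ring using (-‿distribˡ-*; -‿distribʳ-*; -‿involutive; -1*x≈-x)
  open import Algebra.Properties.Group +-group using (x∙y⁻¹≈ε⇒x≈y; inverseˡ-unique; inverseʳ-unique)
  open import Relation.Binary.Reasoning.Setoid setoid

  pattern f0 = zero
  pattern f1 = suc zero
  pattern f2 = suc (suc zero)

  -- A ring solver whose constants are integers.  It normalises the routine
  -- polynomial identities below, including those with constants 0, 1, -1
  -- coming from identity matrices and sign matrices.
  module IntegerCoefficients where
    private
      natR-+ : ∀ m n → natR (m ℕ.+ n) ≈ natR m + natR n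
      natR-+ ℕ.zero n = sym (+-identityˡ _)
      natR-+ (ℕ.suc m) n = trans (+-congˡ (natR-+ m n)) (sym (+-assoc _ _ _))

      natR-* : ∀ m n → natR (m ℕ.* n) ≈ natR m * natR n
      natR-* ℕ.zero n = sym (zeroˡ _)
      natR-* (ℕ.suc m) n = begin
        natR (n ℕ.+ m ℕ.* n)          ≈⟨ natR-+ n (m ℕ.* n) ⟩
        natR n + natR (m ℕ.* n)       ≈⟨ +-congˡ (natR-* m n) ⟩
        natR n + natR m * natR n      ≈⟨ +-congʳ (sym (*-identityˡ _)) ⟩
        1# * natR n + natR m * natR n ≈⟨ sym (distribʳ _ _ _) ⟩
        (1# + natR m) * natR n        ∎

      acr : ACR.AlmostCommutativeRing c ℓ
      acr = ACR.fromCommutativeRing cring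

      open import Algebra.Properties.AbelianGroup +-abelianGroup using (⁻¹-∙-comm)
      -- a solver for identities without constants, used to build the integer one
      open import Tactic.RingSolver.Core.AlmostCommutativeRing using (fromCommutativeRing)
      open import Tactic.RingSolver.NonReflective (fromCommutativeRing cring (λ _ → nothing))
        using (_⊜_; _⊕_; _⊗_; ⊝_) renaming (solve to solve₀)

      -- (a , b) denotes a - b; 0, 1, -1 are denoted literally
      ⟦_⟧ℤ : ℕ × ℕ → Carrier
      ⟦ 0 , 0 ⟧ℤ = 0#
      ⟦ 1 , 0 ⟧ℤ = 1#
      ⟦ 0 , 1 ⟧ℤ = - 1#
      ⟦ a , b ⟧ℤ = natR a - natR b

      ⟦⟧ℤ-diff : ∀ a b → ⟦ a , b ⟧ℤ ≈ natR a - natR b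
      ⟦⟧ℤ-diff 0 0 = sym (-‿inverseʳ 0#)
      ⟦⟧ℤ-diff 1 0 = sym (trans (+-cong (+-identityʳ 1#) (trans (sym (+-identityˡ (- 0#))) (-‿inverseʳ 0#))) (+-identityʳ 1#))
      ⟦⟧ℤ-diff 0 1 = sym (trans (+-identityˡ _) (-‿cong (+-identityʳ 1#)))
      ⟦⟧ℤ-diff 0 (ℕ.suc (ℕ.suc b)) = refl
      ⟦⟧ℤ-diff 1 (ℕ.suc b) = refl
      ⟦⟧ℤ-diff (ℕ.suc (ℕ.suc a)) b = refl

      -- integers as differences of naturals, a ring up to ≡ on representatives
      Coefficients : RawRing _ _
      Coefficients = record
        { Carrier = ℕ × ℕ ; _≈_ = _≡_
        ; _+_ = λ { (a , b) (c , d) → (a ℕ.+ c , b ℕ.+ d) }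
        ; _*_ = λ { (a , b) (c , d) → (a ℕ.* c ℕ.+ b ℕ.* d , a ℕ.* d ℕ.+ b ℕ.* c) }
        ; -_ = λ { (a , b) → (b , a) }
        ; 0# = (0 , 0) ; 1# = (1 , 0) }

      hom : Coefficients ACR.-Raw-AlmostCommutative⟶ acr
      hom = record
        { ⟦_⟧ = ⟦_⟧ℤ
        ; +-homo = λ { (a , b) (c , d) → begin
            ⟦ a ℕ.+ c , b ℕ.+ d ⟧ℤ                   ≈⟨ ⟦⟧ℤ-diff (a ℕ.+ c) (b ℕ.+ d) ⟩
            natR (a ℕ.+ c) - natR (b ℕ.+ d)          ≈⟨ +-cong (natR-+ a c) (-‿cong (natR-+ b d)) ⟩
            (natR a + natR c) - (natR b + natR d)
              ≈⟨ solve₀ 4 (λ A C B D → ((A ⊕ C) ⊕ ⊝ (B ⊕ D)) ⊜ ((A ⊕ ⊝ B) ⊕ (C ⊕ ⊝ D))) refl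
                   (natR a) (natR c) (natR b) (natR d) ⟩
            (natR a - natR b) + (natR c - natR d)    ≈⟨ sym (+-cong (⟦⟧ℤ-diff a b) (⟦⟧ℤ-diff c d)) ⟩
            ⟦ a , b ⟧ℤ + ⟦ c , d ⟧ℤ                  ∎ }
        ; *-homo = λ { (a , b) (c , d) → begin
            ⟦ a ℕ.* c ℕ.+ b ℕ.* d , a ℕ.* d ℕ.+ b ℕ.* c ⟧ℤ
              ≈⟨ ⟦⟧ℤ-diff (a ℕ.* c ℕ.+ b ℕ.* d) (a ℕ.* d ℕ.+ b ℕ.* c) ⟩
            natR (a ℕ.* c ℕ.+ b ℕ.* d) - natR (a ℕ.* d ℕ.+ b ℕ.* c)
              ≈⟨ +-cong (trans (natR-+ (a ℕ.* c) (b ℕ.* d)) (+-cong (natR-* a c) (natR-* b d)))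
                        (-‿cong (trans (natR-+ (a ℕ.* d) (b ℕ.* c)) (+-cong (natR-* a d) (natR-* b c)))) ⟩
            (natR a * natR c + natR b * natR d) - (natR a * natR d + natR b * natR c)
              ≈⟨ differenceProduct (natR a) (natR b) (natR c) (natR d) ⟩
            (natR a - natR b) * (natR c - natR d)
              ≈⟨ sym (*-cong (⟦⟧ℤ-diff a b) (⟦⟧ℤ-diff c d)) ⟩
            ⟦ a , b ⟧ℤ * ⟦ c , d ⟧ℤ ∎ }
        ; -‿homo = λ { (a , b) → begin
            ⟦ b , a ⟧ℤ              ≈⟨ ⟦⟧ℤ-diff b a ⟩
            natR b - natR a
              ≈⟨ trans (+-comm (natR b) (- natR a))
                       (trans (+-congˡ (sym (-‿involutive (natR b)))) (⁻¹-∙-comm (natR a) (- natR b))) ⟩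
            - (natR a - natR b)     ≈⟨ -‿cong (sym (⟦⟧ℤ-diff a b)) ⟩
            - ⟦ a , b ⟧ℤ            ∎ }
        ; 0-homo = refl
        ; 1-homo = refl }
        where
        differenceProduct : ∀ A B C D → (A * C + B * D) - (A * D + B * C) ≈ (A - B) * (C - D)
        differenceProduct A B C D = sym (begin
          (A - B) * (C - D)                                   ≈⟨ distribʳ _ _ _ ⟩
          A * (C - D) + (- B) * (C - D)                       ≈⟨ +-cong (distribˡ _ _ _) (distribˡ _ _ _) ⟩
          (A * C + A * (- D)) + ((- B) * C + (- B) * (- D))
            ≈⟨ +-cong (+-congˡ (sym (-‿distribʳ-* A D)))
                      (+-cong (sym (-‿distribˡ-* B C))
                              (trans (sym (-‿distribˡ-* B (- D))) (trans (-‿cong (sym (-‿distribʳ-* B D))) (-‿involutive _)))) ⟩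
          (A * C + - (A * D)) + (- (B * C) + B * D)
            ≈⟨ solve₀ 4 (λ P Q R S → ((P ⊕ ⊝ R) ⊕ (⊝ S ⊕ Q)) ⊜ ((P ⊕ Q) ⊕ ⊝ (R ⊕ S))) refl (A * C) (B * D) (A * D) (B * C) ⟩
          (A * C + B * D) - (A * D + B * C) ∎)

      decide : ∀ x y → Maybe (⟦ x ⟧ℤ ≈ ⟦ y ⟧ℤ)
      decide (a , b) (c , d) with (a ℕ.+ d) ℕ.≟ (c ℕ.+ b)
      ... | no _ = nothing
      ... | yes a+d≡c+b = just (begin
            ⟦ a , b ⟧ℤ                       ≈⟨ ⟦⟧ℤ-diff a b ⟩
            natR a - natR b                  ≈⟨ sym (+-identityʳ _) ⟩
            (natR a - natR b) + 0#           ≈⟨ +-congˡ (sym (-‿inverseʳ (natR d))) ⟩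
            (natR a - natR b) + (natR d - natR d)
              ≈⟨ solve₀ 3 (λ A B D → ((A ⊕ ⊝ B) ⊕ (D ⊕ ⊝ D)) ⊜ (((A ⊕ D) ⊕ ⊝ B) ⊕ ⊝ D)) refl (natR a) (natR b) (natR d) ⟩
            ((natR a + natR d) - natR b) - natR d
              ≈⟨ +-congʳ (+-congʳ (trans (sym (natR-+ a d)) (trans (reflexive (≡.cong natR a+d≡c+b)) (natR-+ c b)))) ⟩
            ((natR c + natR b) - natR b) - natR d
              ≈⟨ +-congʳ (trans (+-assoc _ _ _) (trans (+-congˡ (-‿inverseʳ _)) (+-identityʳ _))) ⟩
            natR c - natR d                  ≈⟨ sym (⟦⟧ℤ-diff c d) ⟩
            ⟦ c , d ⟧ℤ                       ∎)

    open Algebra.Solver.Ring Coefficients acr hom decide public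
      using (solve; _:=_; _:+_; _:*_; :-_; con)

  open IntegerCoefficients

  IsUnit : Carrier → Set (c ⊔ ℓ)
  IsUnit x = Σ Carrier λ y → x * y ≈ 1#

  unit-* : ∀ {x y} → IsUnit x → IsUnit y → IsUnit (x * y)
  unit-* {x} {y} (x' , xx') (y' , yy') = x' * y' , (begin
    (x * y) * (x' * y') ≈⟨ solve 4 (λ a b c d → (a :* b) :* (c :* d) := (a :* c) :* (b :* d)) refl x y x' y' ⟩
    (x * x') * (y * y') ≈⟨ *-cong xx' yy' ⟩
    1# * 1#             ≈⟨ *-identityˡ 1# ⟩
    1#                  ∎)

  unit≉0 : ∀ {x} → IsUnit x → ¬ (x ≈ 0#)
  unit≉0 {x} (y , xy) x≈0 = nontrivial (begin
    1#     ≈⟨ sym xy ⟩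
    x * y  ≈⟨ *-congʳ x≈0 ⟩
    0# * y ≈⟨ zeroˡ y ⟩
    0#     ∎)

  cancel : ∀ {k x y} → IsUnit k → k * x ≈ k * y → x ≈ y
  cancel {k} {x} {y} (k' , kk') eq = begin
    x              ≈⟨ sym (*-identityˡ x) ⟩
    1# * x         ≈⟨ *-congʳ (sym kk') ⟩
    (k * k') * x   ≈⟨ solve 3 (λ k k' x → (k :* k') :* x := k' :* (k :* x)) refl k k' x ⟩
    k' * (k * x)   ≈⟨ *-congˡ eq ⟩
    k' * (k * y)   ≈⟨ solve 3 (λ k k' y → k' :* (k :* y) := (k :* k') :* y) refl k k' y ⟩
    (k * k') * y   ≈⟨ *-congʳ kk' ⟩
    1# * y         ≈⟨ *-identityˡ y ⟩
    y              ∎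

  cancel0 : ∀ {k x} → IsUnit k → k * x ≈ 0# → x ≈ 0#
  cancel0 {k} u eq = cancel u (trans eq (sym (zeroʳ k)))

  -1≉0 : ¬ (- 1# ≈ 0#)
  -1≉0 -1≈0 = nontrivial (begin
    1#        ≈⟨ sym (-‿involutive 1#) ⟩
    - (- 1#)  ≈⟨ -‿cong -1≈0 ⟩
    - 0#      ≈⟨ trans (sym (+-identityˡ (- 0#))) (-‿inverseʳ 0#) ⟩
    0#        ∎)

  1≉-1 : ¬ (1# ≈ - 1#)
  1≉-1 1≈-1 = char0 1 (begin
    1# + (1# + 0#) ≈⟨ +-congˡ (+-identityʳ 1#) ⟩
    1# + 1#        ≈⟨ +-congˡ 1≈-1 ⟩
    1# + - 1#      ≈⟨ -‿inverseʳ 1# ⟩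
    0#             ∎)

  _≟ₛ_ : (a b : E) → Dec (a ≡ b)
  O ≟ₛ O = yes ≡.refl
  O ≟ₛ P = no λ ()
  O ≟ₛ N = no λ ()
  P ≟ₛ O = no λ ()
  P ≟ₛ P = yes ≡.refl
  P ≟ₛ N = no λ ()
  N ≟ₛ O = no λ ()
  N ≟ₛ P = no λ ()
  N ≟ₛ N = yes ≡.refl

  _*ₛ_ : E → E → E
  O *ₛ _ = O
  P *ₛ b = b
  N *ₛ O = O
  N *ₛ P = N
  N *ₛ N = P

  *ₛ-assoc : ∀ a b d → (a *ₛ b) *ₛ d ≡ a *ₛ (b *ₛ d)
  *ₛ-assoc O b d = ≡.refl
  *ₛ-assoc P b d = ≡.refl
  *ₛ-assoc N O d = ≡.refl
  *ₛ-assoc N P d = ≡.refl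
  *ₛ-assoc N N O = ≡.refl
  *ₛ-assoc N N P = ≡.refl
  *ₛ-assoc N N N = ≡.refl

  *ₛ-square : ∀ a {d} → d ≢ O → (a *ₛ d) *ₛ d ≡ a
  *ₛ-square a {O} d≢O = ⊥-elim (d≢O ≡.refl)
  *ₛ-square O {P} _ = ≡.refl
  *ₛ-square P {P} _ = ≡.refl
  *ₛ-square N {P} _ = ≡.refl
  *ₛ-square O {N} _ = ≡.refl
  *ₛ-square P {N} _ = ≡.refl
  *ₛ-square N {N} _ = ≡.refl

  e-* : ∀ a b → e a * e b ≈ e (a *ₛ b)
  e-* O b = zeroˡ _
  e-* P b = *-identityˡ _
  e-* N O = zeroʳ _
  e-* N P = *-identityʳ _
  e-* N N = solve 0 (con (0 , 1) :* con (0 , 1) := con (1 , 0)) refl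

  e-unit : ∀ {a} → a ≢ O → IsUnit (e a)
  e-unit {O} a≢O = ⊥-elim (a≢O ≡.refl)
  e-unit {P} _ = 1# , *-identityˡ 1#
  e-unit {N} _ = - 1# , e-* N N

  -- distinct signs stay distinct in the field (this uses characteristic ≠ 2)
  e-injective : ∀ {a b} → e a ≈ e b → a ≡ b
  e-injective {O} {O} _ = ≡.refl
  e-injective {O} {P} 0≈1 = ⊥-elim (nontrivial (sym 0≈1))
  e-injective {O} {N} 0≈-1 = ⊥-elim (-1≉0 (sym 0≈-1))
  e-injective {P} {O} 1≈0 = ⊥-elim (nontrivial 1≈0)
  e-injective {P} {P} _ = ≡.refl
  e-injective {P} {N} 1≈-1 = ⊥-elim (1≉-1 1≈-1)
  e-injective {N} {O} -1≈0 = ⊥-elim (-1≉0 -1≈0)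
  e-injective {N} {P} -1≈1 = ⊥-elim (1≉-1 (sym -1≈1))
  e-injective {N} {N} _ = ≡.refl
  ≈M-sym : ∀ {A B} → A ≈M B → B ≈M A
  ≈M-sym p i j = sym (p i j)

  ≈M-trans : ∀ {A B C} → A ≈M B → B ≈M C → A ≈M C
  ≈M-trans p q i j = trans (p i j) (q i j)

  ·-congˡ : ∀ {A A'} B → A ≈M A' → (A · B) ≈M (A' · B)
  ·-congˡ B p i j = +-cong (*-congʳ (p i f0)) (+-cong (*-congʳ (p i f1)) (*-congʳ (p i f2)))

  ·-congʳ : ∀ A {B B'} → B ≈M B' → (A · B) ≈M (A · B')
  ·-congʳ A p i j = +-cong (*-congˡ (p f0 j)) (+-cong (*-congˡ (p f1 j)) (*-congˡ (p f2 j)))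

  ·-assoc : ∀ A B C → ((A · B) · C) ≈M (A · (B · C))
  ·-assoc A B C i j = solve 15 (λ a0 a1 a2 b00 b01 b02 b10 b11 b12 b20 b21 b22 c0 c1 c2 →
       ((a0 :* b00 :+ (a1 :* b10 :+ a2 :* b20)) :* c0 :+ ((a0 :* b01 :+ (a1 :* b11 :+ a2 :* b21)) :* c1 :+ (a0 :* b02 :+ (a1 :* b12 :+ a2 :* b22)) :* c2))
    := (a0 :* (b00 :* c0 :+ (b01 :* c1 :+ b02 :* c2)) :+ (a1 :* (b10 :* c0 :+ (b11 :* c1 :+ b12 :* c2)) :+ a2 :* (b20 :* c0 :+ (b21 :* c1 :+ b22 :* c2))))) refl
    (A i f0) (A i f1) (A i f2) (B f0 f0) (B f0 f1) (B f0 f2) (B f1 f0) (B f1 f1) (B f1 f2) (B f2 f0) (B f2 f1) (B f2 f2) (C f0 j) (C f1 j) (C f2 j)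

  ·-idˡ : ∀ A → (idM · A) ≈M A
  ·-idˡ A f0 j = solve 3 (λ x y z → con (1 , 0) :* x :+ (con (0 , 0) :* y :+ con (0 , 0) :* z) := x) refl (A f0 j) (A f1 j) (A f2 j)
  ·-idˡ A f1 j = solve 3 (λ x y z → con (0 , 0) :* x :+ (con (1 , 0) :* y :+ con (0 , 0) :* z) := y) refl (A f0 j) (A f1 j) (A f2 j)
  ·-idˡ A f2 j = solve 3 (λ x y z → con (0 , 0) :* x :+ (con (0 , 0) :* y :+ con (1 , 0) :* z) := z) refl (A f0 j) (A f1 j) (A f2 j)

  ·-idʳ : ∀ A → (A · idM) ≈M A
  ·-idʳ A i f0 = solve 3 (λ x y z → x :* con (1 , 0) :+ (y :* con (0 , 0) :+ z :* con (0 , 0)) := x) refl (A i f0) (A i f1) (A i f2)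
  ·-idʳ A i f1 = solve 3 (λ x y z → x :* con (0 , 0) :+ (y :* con (1 , 0) :+ z :* con (0 , 0)) := y) refl (A i f0) (A i f1) (A i f2)
  ·-idʳ A i f2 = solve 3 (λ x y z → x :* con (0 , 0) :+ (y :* con (0 , 0) :+ z :* con (1 , 0)) := z) refl (A i f0) (A i f1) (A i f2)

  undoʳ : ∀ X C B → (C · B) ≈M idM → ((X · C) · B) ≈M X
  undoʳ X C B CB≈I = ≈M-trans (·-assoc X C B) (≈M-trans (·-congʳ X CB≈I) (·-idʳ X))

  undoˡ : ∀ A' A X → (A' · A) ≈M idM → (A' · (A · X)) ≈M X
  undoˡ A' A X A'A≈I = ≈M-trans (≈M-sym (·-assoc A' A X)) (≈M-trans (·-congˡ X A'A≈I) (·-idˡ X))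

  _⋆_ : Carrier → Mat → Mat
  (k ⋆ A) i j = k * A i j

  ⋆-cong : ∀ k {X Y} → X ≈M Y → (k ⋆ X) ≈M (k ⋆ Y)
  ⋆-cong k p i j = *-congˡ (p i j)

  ⋆-·ˡ : ∀ k X Y → (k ⋆ (X · Y)) ≈M ((k ⋆ X) · Y)
  ⋆-·ˡ k X Y i j = solve 7 (λ k x0 x1 x2 y0 y1 y2 → k :* (x0 :* y0 :+ (x1 :* y1 :+ x2 :* y2)) := (k :* x0) :* y0 :+ ((k :* x1) :* y1 :+ (k :* x2) :* y2)) refl
    k (X i f0) (X i f1) (X i f2) (Y f0 j) (Y f1 j) (Y f2 j)

  ⋆-·ʳ : ∀ k X Y → (k ⋆ (X · Y)) ≈M (X · (k ⋆ Y))
  ⋆-·ʳ k X Y i j = solve 7 (λ k x0 x1 x2 y0 y1 y2 → k :* (x0 :* y0 :+ (x1 :* y1 :+ x2 :* y2)) := x0 :* (k :* y0) :+ (x1 :* (k :* y1) :+ x2 :* (k :* y2))) refl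
    k (X i f0) (X i f1) (X i f2) (Y f0 j) (Y f1 j) (Y f2 j)

  ·-multipleˡ : ∀ {A} a Q X → A ≈M (a ⋆ Q) → (A · X) ≈M (a ⋆ (Q · X))
  ·-multipleˡ a Q X A≈aQ = ≈M-trans (·-congˡ X A≈aQ) (≈M-sym (⋆-·ˡ a Q X))

  ·-multipleʳ : ∀ X {B} b Q → B ≈M (b ⋆ Q) → (X · B) ≈M (b ⋆ (X · Q))
  ·-multipleʳ X b Q B≈bQ = ≈M-trans (·-congʳ X B≈bQ) (≈M-sym (⋆-·ʳ b X Q))

  _∝_ : Mat → Mat → Set (c ⊔ ℓ)
  U ∝ V = Σ Carrier λ k → IsUnit k × ((k ⋆ U) ≈M V)

  -- Q has rank at most one: it is an outer product α βᵀ.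
  RankOne : Mat → Set (c ⊔ ℓ)
  RankOne Q = Σ (Fin 3 → Carrier) λ α → Σ (Fin 3 → Carrier) λ β → ∀ i j → Q i j ≈ α i * β j

  rankOne-≈ : ∀ {Q Q'} → Q ≈M Q' → RankOne Q → RankOne Q'
  rankOne-≈ Q≈Q' (α , β , Q≈αβ) = α , β , λ i j → trans (sym (Q≈Q' i j)) (Q≈αβ i j)

  rankOne-left : ∀ A {Q} → RankOne Q → RankOne (A · Q)
  rankOne-left A (α , β , Q≈αβ) = (λ i → A i f0 * α f0 + (A i f1 * α f1 + A i f2 * α f2)) , β , λ i j →
    trans (+-cong (*-congˡ (Q≈αβ f0 j)) (+-cong (*-congˡ (Q≈αβ f1 j)) (*-congˡ (Q≈αβ f2 j))))
      (solve 7 (λ a0 a1 a2 x0 x1 x2 b → a0 :* (x0 :* b) :+ (a1 :* (x1 :* b) :+ a2 :* (x2 :* b)) := (a0 :* x0 :+ (a1 :* x1 :+ a2 :* x2)) :* b) refl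
        (A i f0) (A i f1) (A i f2) (α f0) (α f1) (α f2) (β j))

  rankOne-right : ∀ {Q} A → RankOne Q → RankOne (Q · A)
  rankOne-right A (α , β , Q≈αβ) = α , (λ j → β f0 * A f0 j + (β f1 * A f1 j + β f2 * A f2 j)) , λ i j →
    trans (+-cong (*-congʳ (Q≈αβ i f0)) (+-cong (*-congʳ (Q≈αβ i f1)) (*-congʳ (Q≈αβ i f2))))
      (solve 7 (λ a0 a1 a2 x0 x1 x2 b → (b :* x0) :* a0 :+ ((b :* x1) :* a1 :+ (b :* x2) :* a2) := b :* (x0 :* a0 :+ (x1 :* a1 :+ x2 :* a2))) refl
        (A f0 j) (A f1 j) (A f2 j) (β f0) (β f1) (β f2) (α i))

  rankOne-scale : ∀ k {Q} → RankOne Q → RankOne (k ⋆ Q)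
  rankOne-scale k (α , β , Q≈αβ) = (λ i → k * α i) , β , λ i j → trans (*-congˡ (Q≈αβ i j)) (sym (*-assoc _ _ _))

  rankOne-minor : ∀ {Q} → RankOne Q → ∀ a b c d → Q a b * Q c d ≈ Q a d * Q c b
  rankOne-minor (α , β , Q≈αβ) a b c d = begin
    _ * _                   ≈⟨ *-cong (Q≈αβ a b) (Q≈αβ c d) ⟩
    (α a * β b) * (α c * β d) ≈⟨ solve 4 (λ x y z w → (x :* y) :* (z :* w) := (x :* w) :* (z :* y)) refl (α a) (β b) (α c) (β d) ⟩
    (α a * β d) * (α c * β b) ≈⟨ sym (*-cong (Q≈αβ a d) (Q≈αβ c b)) ⟩
    _ * _                   ∎

  -- Rank one is invariant under X ↦ A X C for invertible A, C, and under
  -- proportionality; this is what makes ranks visible to the group G.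
  rankOne-invariant : ∀ A A' C C' {X Y} → (A' · A) ≈M idM → (C · C') ≈M idM →
                      ((A · X) · C) ∝ Y → RankOne X ⇔ RankOne Y
  rankOne-invariant A A' C C' {X} {Y} A'A≈I CC'≈I (k , (k' , kk') , kAXC≈Y) = mk⇔ forth back
    where
    forth : RankOne X → RankOne Y
    forth rX = rankOne-≈ kAXC≈Y (rankOne-scale k (rankOne-right C (rankOne-left A rX)))

    unscale : (k' ⋆ Y) ≈M ((A · X) · C)
    unscale i j = begin
      k' * Y i j               ≈⟨ *-congˡ (sym (kAXC≈Y i j)) ⟩
      k' * (k * ((A · X) · C) i j) ≈⟨ solve 3 (λ k k' x → k' :* (k :* x) := (k :* k') :* x) refl k k' _ ⟩
      (k * k') * ((A · X) · C) i j ≈⟨ *-congʳ kk' ⟩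
      1# * ((A · X) · C) i j   ≈⟨ *-identityˡ _ ⟩
      ((A · X) · C) i j        ∎

    back : RankOne Y → RankOne X
    back rY = rankOne-≈ (≈M-trans (·-congˡ C' (≈M-sym (·-assoc A' (A · X) C)))
                          (≈M-trans (undoʳ (A' · (A · X)) C C' CC'≈I) (undoˡ A' A X A'A≈I)))
                (rankOne-right C' (rankOne-left A' (rankOne-≈ unscale (rankOne-scale k' rY))))

  -- Sign matrices, with entries in {0, 1, -1}, as occurring in S_2fix; their
  -- ranks and supports can be decided by computation.

  SM : Set
  SM = Fin 3 → Fin 3 → E

  ⟪_⟫ : SM → Mat
  ⟪ x ⟫ i j = e (x i j)

  trₛ : SM → SM
  trₛ x i j = x j i

  MinorsVanish : SM → Set
  MinorsVanish x = ∀ a b c d → (x a b *ₛ x c d) ≡ (x a d *ₛ x c b)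

  minorsVanish? : ∀ x → Dec (MinorsVanish x)
  minorsVanish? x = all? λ a → all? λ b → all? λ c → all? λ d → (x a b *ₛ x c d) ≟ₛ (x a d *ₛ x c b)

  Pivot : SM → Set
  Pivot x = ∃ λ i → ∃ λ j → x i j ≢ O

  pivot? : ∀ x → Dec (Pivot x)
  pivot? x = any? λ i → any? λ j → ¬? (x i j ≟ₛ O)

  rankOne⇔minorsVanish : ∀ x → RankOne ⟪ x ⟫ ⇔ MinorsVanish x
  rankOne⇔minorsVanish x = mk⇔ minors outer
    where
    minors : RankOne ⟪ x ⟫ → MinorsVanish x
    minors r a b c d = e-injective (begin
      e (x a b *ₛ x c d)      ≈⟨ sym (e-* (x a b) (x c d)) ⟩
      e (x a b) * e (x c d)   ≈⟨ rankOne-minor r a b c d ⟩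
      e (x a d) * e (x c b)   ≈⟨ e-* (x a d) (x c b) ⟩
      e (x a d *ₛ x c b)      ∎)

    -- with a pivot (p, q): x i j = x i q · x p j · x p q
    outer : MinorsVanish x → RankOne ⟪ x ⟫
    outer mv with pivot? x
    ... | yes (p , q , x≢O) = (λ i → e (x i q)) , (λ j → e (x p j *ₛ x p q)) , λ i j → begin
          e (x i j)                           ≈⟨ reflexive (≡.cong e (factor i j)) ⟩
          e (x i q *ₛ (x p j *ₛ x p q))       ≈⟨ sym (e-* (x i q) _) ⟩
          e (x i q) * e (x p j *ₛ x p q)      ∎
      where
      factor : ∀ i j → x i j ≡ x i q *ₛ (x p j *ₛ x p q)
      factor i j = ≡.trans (≡.sym (*ₛ-square (x i j) x≢O))
                  (≡.trans (≡.cong (_*ₛ x p q) (mv i j p q)) (*ₛ-assoc (x i q) (x p j) (x p q)))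
    ... | no noPivot = (λ _ → 0#) , (λ _ → 0#) , λ i j → trans (reflexive (≡.cong e (vanishes i j))) (sym (zeroˡ 0#))
      where
      vanishes : ∀ i j → x i j ≡ O
      vanishes i j with x i j ≟ₛ O
      ... | yes x≡O = x≡O
      ... | no x≢O = ⊥-elim (noPivot (i , j , x≢O))

  -- Linear forms with sign coefficients, written without zero terms: for a
  -- concrete sign vector s, `signed s v` computes to the expected expression
  -- such as  v₁ + - v₂, so that entries of  A · ⟪ x ⟫  read as in the paper.

  term : E → Carrier → Maybe Carrier
  term O _ = nothing
  term P v = just v
  term N v = just (- v)

  _⊞_ : Maybe Carrier → Maybe Carrier → Maybe Carrier
  nothing ⊞ m       = m
  just a  ⊞ nothing = just a
  just a  ⊞ just b  = just (a + b)

  value : Maybe Carrier → Carrier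
  value nothing  = 0#
  value (just a) = a

  signed : (Fin 3 → E) → (Fin 3 → Carrier) → Carrier
  signed s v = value (term (s f0) (v f0) ⊞ (term (s f1) (v f1) ⊞ term (s f2) (v f2)))

  value-⊞ : ∀ m m' → value (m ⊞ m') ≈ value m + value m'
  value-⊞ nothing  m'        = sym (+-identityˡ _)
  value-⊞ (just a) nothing   = sym (+-identityʳ a)
  value-⊞ (just a) (just b)  = refl

  value-term : ∀ s v → e s * v ≈ value (term s v)
  value-term O v = zeroˡ v
  value-term P v = *-identityˡ v
  value-term N v = -1*x≈-x v

  row-signed : ∀ (s : Fin 3 → E) (v : Fin 3 → Carrier) →
               e (s f0) * v f0 + (e (s f1) * v f1 + e (s f2) * v f2) ≈ signed s v
  row-signed s v = begin
    e (s f0) * v f0 + (e (s f1) * v f1 + e (s f2) * v f2)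
      ≈⟨ +-cong (value-term (s f0) (v f0)) (+-cong (value-term (s f1) (v f1)) (value-term (s f2) (v f2))) ⟩
    value t0 + (value t1 + value t2)   ≈⟨ +-congˡ (sym (value-⊞ t1 t2)) ⟩
    value t0 + value (t1 ⊞ t2)         ≈⟨ sym (value-⊞ t0 (t1 ⊞ t2)) ⟩
    signed s v                         ∎
    where
    t0 = term (s f0) (v f0)
    t1 = term (s f1) (v f1)
    t2 = term (s f2) (v f2)

  column-signed : ∀ (s : Fin 3 → E) (v : Fin 3 → Carrier) →
                  v f0 * e (s f0) + (v f1 * e (s f1) + v f2 * e (s f2)) ≈ signed s v
  column-signed s v = trans (+-cong (*-comm _ _) (+-cong (*-comm _ _) (*-comm _ _))) (row-signed s v)

  ≈T-sym : ∀ {X Y : Tensor} → X ≈T Y → Y ≈T X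
  ≈T-sym p a b d e' f g = sym (p a b d e' f g)

  ≈T-trans : ∀ {X Y Z : Tensor} → X ≈T Y → Y ≈T Z → X ≈T Z
  ≈T-trans p q a b d e' f g = trans (p a b d e' f g) (q a b d e' f g)

  transport : ∀ {s s' t t'} → s ≡ s' → t ≡ t' → ⟦ s' ⟧ ≈T ⟦ t' ⟧ → ⟦ s ⟧ ≈T ⟦ t ⟧
  transport ≡.refl ≡.refl eq = eq

  -- σ and τ act on Mat₃^{⊗3} by permuting tensor indices, so they
  -- preserve equality of tensors
  σ-cong : ∀ {s t} → ⟦ s ⟧ ≈T ⟦ t ⟧ → ⟦ σ s ⟧ ≈T ⟦ σ t ⟧
  σ-cong p a b d e' f g = trans (sym (rotate _ _ _)) (trans (p f g a b d e') (rotate _ _ _))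
    where
    rotate : ∀ x y z → x * y * z ≈ y * z * x
    rotate = solve 3 (λ x y z → x :* y :* z := y :* z :* x) refl

  τ-cong : ∀ {s t} → ⟦ s ⟧ ≈T ⟦ t ⟧ → ⟦ τ s ⟧ ≈T ⟦ τ t ⟧
  τ-cong p a b d e' f g = trans (swap _ _ _) (trans (p b a g f e' d) (swap _ _ _))
    where
    swap : ∀ x y z → x * y * z ≈ x * z * y
    swap = solve 3 (λ x y z → x :* y :* z := x :* z :* y) refl

  σ^-cong : ∀ a {s t} → ⟦ s ⟧ ≈T ⟦ t ⟧ → ⟦ σ^ a s ⟧ ≈T ⟦ σ^ a t ⟧
  σ^-cong f0 p = p
  σ^-cong f1 p = σ-cong p
  σ^-cong f2 p = σ-cong (σ-cong p)

  τ^-cong : ∀ b {s t} → ⟦ s ⟧ ≈T ⟦ t ⟧ → ⟦ τ^ b s ⟧ ≈T ⟦ τ^ b t ⟧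
  τ^-cong false p = p
  τ^-cong true  p = τ-cong p

  -_ₐ : Fin 3 → Fin 3
  - f0 ₐ = f0
  - f1 ₐ = f2
  - f2 ₐ = f1

  σ^-inverse : ∀ a t → σ^ (- a ₐ) (σ^ a t) ≡ t
  σ^-inverse f0 t = ≡.refl
  σ^-inverse f1 t = ≡.refl
  σ^-inverse f2 t = ≡.refl

  σ^-section : ∀ a t → σ^ a (σ^ (- a ₐ) t) ≡ t
  σ^-section f0 t = ≡.refl
  σ^-section f1 t = ≡.refl
  σ^-section f2 t = ≡.refl

  τ^-involutive : ∀ b t → τ^ b (τ^ b t) ≡ t
  τ^-involutive false t = ≡.refl
  τ^-involutive true  t = ≡.refl

  unwind : ∀ g h k a b t s → ⟦ act (elem g h k a b) t ⟧ ≈T ⟦ s ⟧ →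
           ⟦ sandwich g h k t ⟧ ≈T ⟦ σ^ (- a ₐ) (τ^ b s) ⟧
  unwind g h k a b t s p =
    ≡.subst (λ u → ⟦ u ⟧ ≈T _)
      (≡.trans (≡.cong (σ^ (- a ₐ)) (τ^-involutive b _)) (σ^-inverse a _))
      (σ^-cong (- a ₐ) (τ^-cong b p))

  ST : Set
  ST = SM × SM × SM

  ⟪_⟫ₜ : ST → Triple
  ⟪ x , y , z ⟫ₜ = ⟪ x ⟫ , ⟪ y ⟫ , ⟪ z ⟫

  σₛ : ST → ST
  σₛ (x , y , z) = y , z , x

  τₛ : ST → ST
  τₛ (x , y , z) = trₛ x , trₛ z , trₛ y

  σₛ^ : Fin 3 → ST → ST
  σₛ^ f0 t = t
  σₛ^ f1 t = σₛ t
  σₛ^ f2 t = σₛ (σₛ t)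

  τₛ^ : Bool → ST → ST
  τₛ^ false t = t
  τₛ^ true  t = τₛ t

  σ^-⟪⟫ : ∀ a t → σ^ a ⟪ t ⟫ₜ ≡ ⟪ σₛ^ a t ⟫ₜ
  σ^-⟪⟫ f0 t = ≡.refl
  σ^-⟪⟫ f1 t = ≡.refl
  σ^-⟪⟫ f2 t = ≡.refl

  τ^-⟪⟫ : ∀ b t → τ^ b ⟪ t ⟫ₜ ≡ ⟪ τₛ^ b t ⟫ₜ
  τ^-⟪⟫ false t = ≡.refl
  τ^-⟪⟫ true  t = ≡.refl

  _≐_ : SM → SM → Set
  x ≐ y = ∀ i j → x i j ≡ y i j

  _≐ₜ_ : ST → ST → Set
  (x , y , z) ≐ₜ (x' , y' , z') = x ≐ x' × y ≐ y' × z ≐ z'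

  _≐ₜ?_ : ∀ s t → Dec (s ≐ₜ t)
  (x , y , z) ≐ₜ? (x' , y' , z') = entrywise x x' ×-dec entrywise y y' ×-dec entrywise z z'
    where
    entrywise : ∀ u v → Dec (u ≐ v)
    entrywise u v = all? λ i → all? λ j → u i j ≟ₛ v i j

  ≐ₜ⇒≈T : ∀ s t → s ≐ₜ t → ⟦ ⟪ s ⟫ₜ ⟧ ≈T ⟦ ⟪ t ⟫ₜ ⟧
  ≐ₜ⇒≈T _ _ (x≐ , y≐ , z≐) a b d e' f g =
    *-cong (*-cong (reflexive (≡.cong e (x≐ a b))) (reflexive (≡.cong e (y≐ d e')))) (reflexive (≡.cong e (z≐ f g)))

  Pivots : ST → Set
  Pivots (x , y , z) = Pivot x × Pivot y × Pivot z

  pivots? : ∀ t → Dec (Pivots t)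
  pivots? (x , y , z) = pivot? x ×-dec pivot? y ×-dec pivot? z

  pivots-τ : ∀ b {t} → Pivots t → Pivots (τₛ^ b t)
  pivots-τ false ps = ps
  pivots-τ true ((i , j , x≢O) , (i' , j' , y≢O) , (i'' , j'' , z≢O)) =
    (j , i , x≢O) , (j'' , i'' , z≢O) , (j' , i' , y≢O)

  pivots-σ : ∀ {t} → Pivots t → Pivots (σₛ t)
  pivots-σ (px , py , pz) = py , pz , px

  record Maps (g h k : GL) (t t' : ST) : Set ℓ where
    constructor maps
    field tensors : ⟦ sandwich g h k ⟪ t ⟫ₜ ⟧ ≈T ⟦ ⟪ t' ⟫ₜ ⟧

  Maps-rotate : ∀ {g h k t t'} → Maps g h k t t' → Maps h k g (σₛ t) (σₛ t')
  Maps-rotate (maps eq) = maps (σ-cong eq)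

  -- a rank one tensor determines its factors up to unit scalars: compare
  -- the first factors at entries where the other two factors are units
  first-proportional : ∀ {U V W} {u v w : SM} → ⟦ (U , V , W) ⟧ ≈T ⟦ (⟪ u ⟫ , ⟪ v ⟫ , ⟪ w ⟫) ⟧ →
                       Pivot u → Pivot v → Pivot w → U ∝ ⟪ u ⟫
  first-proportional {U} {V} {W} {u} {v} {w} UVW≈uvw (a , b , u≢O) (d , e' , v≢O) (f , g , w≢O) =
    k , k-unit , kU≈u
    where
    v⁻¹ = proj₁ (e-unit v≢O)
    w⁻¹ = proj₁ (e-unit w≢O)
    k = (V d e' * W f g) * (v⁻¹ * w⁻¹)

    kU≈u : (k ⋆ U) ≈M ⟪ u ⟫
    kU≈u i j = begin
      k * U i j
        ≈⟨ solve 5 (λ x y z s t → (y :* z) :* (s :* t) :* x := (x :* y :* z) :* (s :* t)) refl (U i j) (V d e') (W f g) v⁻¹ w⁻¹ ⟩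
      (U i j * V d e' * W f g) * (v⁻¹ * w⁻¹)
        ≈⟨ *-congʳ (UVW≈uvw i j d e' f g) ⟩
      (e (u i j) * e (v d e') * e (w f g)) * (v⁻¹ * w⁻¹)
        ≈⟨ solve 5 (λ x y z s t → (x :* y :* z) :* (s :* t) := x :* ((y :* s) :* (z :* t))) refl
             (e (u i j)) (e (v d e')) (e (w f g)) v⁻¹ w⁻¹ ⟩
      e (u i j) * ((e (v d e') * v⁻¹) * (e (w f g) * w⁻¹))
        ≈⟨ *-congˡ (*-cong (proj₂ (e-unit v≢O)) (proj₂ (e-unit w≢O))) ⟩
      e (u i j) * (1# * 1#)
        ≈⟨ trans (*-congˡ (*-identityˡ 1#)) (*-identityʳ _) ⟩
      e (u i j) ∎

    k-unit : IsUnit k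
    k-unit = U a b * proj₁ (e-unit u≢O) , trans (sym (*-assoc _ _ _)) (trans (*-congʳ (kU≈u a b)) (proj₂ (e-unit u≢O)))

  record Intertwines (A B : Mat) (x y : SM) : Set (c ⊔ ℓ) where
    field
      scale : Carrier
      scale-unit : IsUnit scale
      equation : (scale ⋆ (A · ⟪ x ⟫)) ≈M (⟪ y ⟫ · B)

    entry : ∀ i j → scale * signed (λ l → x l j) (A i) ≈ signed (y i) (λ l → B l j)
    entry i j = begin
      scale * signed (λ l → x l j) (A i) ≈⟨ *-congˡ (sym (column-signed (λ l → x l j) (A i))) ⟩
      scale * (A · ⟪ x ⟫) i j            ≈⟨ equation i j ⟩
      (⟪ y ⟫ · B) i j                    ≈⟨ row-signed (y i) (λ l → B l j) ⟩
      signed (y i) (λ l → B l j)         ∎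

  intertwines : ∀ {g h k x y z x' y' z'} → Maps g h k (x , y , z) (x' , y' , z') →
                Pivots (x' , y' , z') → Intertwines (GL.mat g) (GL.mat h) x x'
  intertwines {g} {h} {x = x} {x' = x'} (maps m) (px , py , pz) = record
    { scale = k ; scale-unit = k-unit
    ; equation = ≈M-trans (⋆-cong k (≈M-sym (undoʳ (G · ⟪ x ⟫) (GL.inv h) (GL.mat h) (GL.inv-l h))))
                 (≈M-trans (⋆-·ˡ k ((G · ⟪ x ⟫) · GL.inv h) (GL.mat h)) (·-congˡ (GL.mat h) kGxh⁻¹≈x')) }
    where
    G = GL.mat g
    proportional = first-proportional m px py pz
    k = proj₁ proportional
    k-unit = proj₁ (proj₂ proportional)
    kGxh⁻¹≈x' = proj₂ (proj₂ proportional)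

  profile : ST → Bool × Bool × Bool
  profile (x , y , z) = does (minorsVanish? x) , does (minorsVanish? y) , does (minorsVanish? z)

  profile-invariant : ∀ {g h k} t t' → Maps g h k t t' → Pivots t' → profile t ≡ profile t'
  profile-invariant {g} {h} {k} (x , y , z) (x' , y' , z') (maps m) (px , py , pz) =
    ≡.cong₂ _,_ (same g h x x' (first-proportional m px py pz))
      (≡.cong₂ _,_ (same h k y y' (first-proportional (σ-cong m) py pz px))
                   (same k g z z' (first-proportional (σ-cong (σ-cong m)) pz px py)))
    where
    same : ∀ a b u u' → ((GL.mat a · ⟪ u ⟫) · GL.inv b) ∝ ⟪ u' ⟫ →
           does (minorsVanish? u) ≡ does (minorsVanish? u')
    same a b u u' prop = does-⇔
      (rankOne⇔minorsVanish u' ⇔-∘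
        (rankOne-invariant (GL.mat a) (GL.inv a) (GL.inv b) (GL.mat b) (GL.inv-l a) (GL.inv-l b) prop
         ⇔-∘ ⇔-sym (rankOne⇔minorsVanish u)))
      (minorsVanish? u) (minorsVanish? u')

  rows : E → E → E → E → E → E → E → E → E → SM
  rows a₁ a₂ a₃ b₁ b₂ b₃ c₁ c₂ c₃ i j =
    lookup (lookup ((a₁ ∷ a₂ ∷ a₃ ∷ []) ∷ (b₁ ∷ b₂ ∷ b₃ ∷ []) ∷ (c₁ ∷ c₂ ∷ c₃ ∷ []) ∷ []) i) j

  cubeₛ : SM → Vec ST 1
  cubeₛ m = (m , m , m) ∷ []

  cycₛ : SM → SM → SM → Vec ST 3
  cycₛ p q r = (p , q , r) ∷ (q , r , p) ∷ (r , p , q) ∷ []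

  -- the first cyclic family (p, q, r) of S_2fix; it pins down g, h and k
  p q r : SM
  p = rows O P O  O O P  O O O
  q = rows O O O  O P N  O P N
  r = rows O O O  P O N  O O O

  Sₛ-vec : Vec ST 23
  Sₛ-vec =
       cubeₛ (rows P O O  O O P  O O P)
    ++ cubeₛ (rows O O O  O P N  O O O)
    ++ cycₛ p q r
    ++ cycₛ (rows O N P  O O O  O O O) (rows O O O  O O O  O O P) (rows O O O  O O O  P O O)
    ++ cycₛ (rows P O O  P O O  O O O) (rows O N P  O O O  O O O) (rows O O O  O O O  O P O)
    ++ cycₛ (rows P O O  O O P  O O O) (rows O P O  O O P  O O P) (rows O O O  P O N  O P N)
    ++ cycₛ (rows P O O  O O O  O O O) (rows O O P  O O P  O O P) (rows O O O  O O O  P N O)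
    ++ cycₛ (rows O O O  O O P  O O O) (rows O P O  O P O  O P O) (rows O O O  N P O  O O O)
    ++ cycₛ (rows O O O  O O P  O O P) (rows P O O  P O O  P O O) (rows N P O  O O O  O O O)

  Sₛ : Fin 23 → ST
  Sₛ = lookup Sₛ-vec

  S2fix-signs : ∀ j → S2fix j ≡ ⟪ Sₛ j ⟫ₜ
  S2fix-signs j = lookup-map j ⟪_⟫ₜ Sₛ-vec

  _≟ₚ_ : (s t : Bool × Bool × Bool) → Dec (s ≡ t)
  _≟ₚ_ = ≡-dec Bool._≟_ (≡-dec Bool._≟_ Bool._≟_)

  UniqueProfile : Bool → Fin 23 → Fin 23 → Set
  UniqueProfile b i i' = ∀ j → profile (τₛ^ b (Sₛ j)) ≡ profile (Sₛ i) → j ≡ i'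

  -- Finite facts about S_2fix, established by evaluating decision procedures.
  -- They are opaque, so that these procedures are never unfolded elsewhere.
  opaque
    pivots : ∀ j → Pivots (Sₛ j)
    pivots = from-yes (all? λ j → pivots? (Sₛ j))

    closed : ∀ b a j → ∃ λ j' → σₛ^ a (τₛ^ b (Sₛ j)) ≐ₜ τₛ^ b (Sₛ j')
    closed false = from-yes (all? λ a → all? λ j → any? λ j' → σₛ^ a (Sₛ j) ≐ₜ? Sₛ j')
    closed true  = from-yes (all? λ a → all? λ j → any? λ j' → σₛ^ a (τₛ (Sₛ j)) ≐ₜ? τₛ (Sₛ j'))

    unique-profile₂ : ∀ b → UniqueProfile b (# 2) (# 2)
    unique-profile₂ false = from-yes (all? λ j → (profile (Sₛ j) ≟ₚ profile (Sₛ (# 2))) →-dec (j ≟ # 2))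
    unique-profile₂ true  = from-yes (all? λ j → (profile (τₛ (Sₛ j)) ≟ₚ profile (Sₛ (# 2))) →-dec (j ≟ # 2))

    unique-profile₃ : ∀ b → UniqueProfile b (# 3) (if b then # 4 else # 3)
    unique-profile₃ false = from-yes (all? λ j → (profile (Sₛ j) ≟ₚ profile (Sₛ (# 3))) →-dec (j ≟ # 3))
    unique-profile₃ true  = from-yes (all? λ j → (profile (τₛ (Sₛ j)) ≟ₚ profile (Sₛ (# 3))) →-dec (j ≟ # 4))

    unique-profile₄ : ∀ b → UniqueProfile b (# 4) (if b then # 3 else # 4)
    unique-profile₄ false = from-yes (all? λ j → (profile (Sₛ j) ≟ₚ profile (Sₛ (# 4))) →-dec (j ≟ # 4))
    unique-profile₄ true  = from-yes (all? λ j → (profile (τₛ (Sₛ j)) ≟ₚ profile (Sₛ (# 4))) →-dec (j ≟ # 3))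

  sum-vanishes : ∀ {k x y u v} → IsUnit k → k * x ≈ u → k * y ≈ v → u + v ≈ 0# → x + y ≈ 0#
  sum-vanishes {k} {x} {y} {u} {v} k-unit kx≈u ky≈v u+v≈0 = cancel0 k-unit (begin
    k * (x + y)     ≈⟨ distribˡ k x y ⟩
    k * x + k * y   ≈⟨ +-cong kx≈u ky≈v ⟩
    u + v           ≈⟨ u+v≈0 ⟩
    0#              ∎)

  sum-vanishes′ : ∀ {k x y u v} → k * x ≈ u → k * y ≈ v → x + y ≈ 0# → u + v ≈ 0#
  sum-vanishes′ {k} {x} {y} {u} {v} kx≈u ky≈v x+y≈0 = begin
    u + v           ≈⟨ sym (+-cong kx≈u ky≈v) ⟩
    k * x + k * y   ≈⟨ sym (distribˡ k x y) ⟩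
    k * (x + y)     ≈⟨ *-congˡ x+y≈0 ⟩
    k * 0#          ≈⟨ zeroʳ k ⟩
    0#              ∎

  scaled-zero : ∀ {k x} → k * 0# ≈ x → x ≈ 0#
  scaled-zero {k} k0≈x = trans (sym k0≈x) (zeroʳ k)

  -- Case without τ: if g and h intertwine each of p, q, r with itself, then
  -- g has the left shape and h the right shape; a matrix having both shapes
  -- is scalar.

  record LeftShape (A : Mat) : Set ℓ where
    field
      a01 : A f0 f1 ≈ 0#
      a02 : A f0 f2 ≈ 0#
      a20 : A f2 f0 ≈ 0#
      a21 : A f2 f1 ≈ 0#
      a11+a12 : A f1 f1 + A f1 f2 ≈ A f2 f2

  record RightShape (B : Mat) : Set ℓ where
    field
      b10 : B f1 f0 ≈ 0#
      b12 : B f1 f2 ≈ 0#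
      b-sum : (B f0 f0 - B f2 f0) + (B f0 f2 - B f2 f2) ≈ 0#

  shapes : ∀ {A B} → Intertwines A B p p → Intertwines A B q q → Intertwines A B r r →
           LeftShape A × RightShape B
  shapes {A} {B} Hp Hq Hr = left , right
    where
    module Hp = Intertwines Hp
    module Hq = Intertwines Hq
    module Hr = Intertwines Hr
    a01 = cancel0 Hr.scale-unit (Hr.entry f0 f0)
    a21 = cancel0 Hp.scale-unit (Hp.entry f2 f2)
    left : LeftShape A
    left = record
      { a01 = a01
      ; a02 = begin
          A f0 f2               ≈⟨ sym (+-identityˡ _) ⟩
          0# + A f0 f2          ≈⟨ +-congʳ (sym a01) ⟩
          A f0 f1 + A f0 f2     ≈⟨ cancel0 Hq.scale-unit (Hq.entry f0 f1) ⟩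
          0#                    ∎
      ; a20 = cancel0 Hp.scale-unit (Hp.entry f2 f1)
      ; a21 = a21
      ; a11+a12 = begin
          A f1 f1 + A f1 f2     ≈⟨ cancel Hq.scale-unit (trans (Hq.entry f1 f1) (sym (Hq.entry f2 f1))) ⟩
          A f2 f1 + A f2 f2     ≈⟨ +-congʳ a21 ⟩
          0# + A f2 f2          ≈⟨ +-identityˡ _ ⟩
          A f2 f2               ∎ }
    right : RightShape B
    right = record
      { b10 = scaled-zero (Hp.entry f0 f0)
      ; b12 = trans (sym (Hp.entry f0 f2)) (trans (*-congˡ a01) (zeroʳ _))
      ; b-sum = sum-vanishes′ (Hr.entry f1 f0) (Hr.entry f1 f2) (-‿inverseʳ (A f1 f1)) }

  both-shapes⇒scalar : ∀ {Q} → LeftShape Q → RightShape Q → Q ≈M (Q f2 f2 ⋆ idM)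
  both-shapes⇒scalar {Q} L R = λ
    { f0 f0 → trans q00≈q22 (sym (*-identityʳ _)) ; f0 f1 → off-diagonal L.a01 ; f0 f2 → off-diagonal L.a02
    ; f1 f0 → off-diagonal R.b10 ; f1 f1 → trans q11≈q22 (sym (*-identityʳ _)) ; f1 f2 → off-diagonal R.b12
    ; f2 f0 → off-diagonal L.a20 ; f2 f1 → off-diagonal L.a21 ; f2 f2 → sym (*-identityʳ _) }
    where
    module L = LeftShape L
    module R = RightShape R
    off-diagonal : ∀ {x} → x ≈ 0# → x ≈ Q f2 f2 * 0#
    off-diagonal x≈0 = trans x≈0 (sym (zeroʳ _))
    q00≈q22 : Q f0 f0 ≈ Q f2 f2
    q00≈q22 = x∙y⁻¹≈ε⇒x≈y _ _ (begin
      Q f0 f0 - Q f2 f2                             ≈⟨ solve 2 (λ x y → x :+ :- y := (x :+ :- con (0 , 0)) :+ (con (0 , 0) :+ :- y)) refl (Q f0 f0) (Q f2 f2) ⟩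
      (Q f0 f0 - 0#) + (0# - Q f2 f2)               ≈⟨ +-cong (+-congˡ (-‿cong (sym L.a20))) (+-congʳ (sym L.a02)) ⟩
      (Q f0 f0 - Q f2 f0) + (Q f0 f2 - Q f2 f2)     ≈⟨ R.b-sum ⟩
      0#                                            ∎)
    q11≈q22 : Q f1 f1 ≈ Q f2 f2
    q11≈q22 = begin
      Q f1 f1             ≈⟨ sym (+-identityʳ _) ⟩
      Q f1 f1 + 0#        ≈⟨ +-congˡ (sym R.b12) ⟩
      Q f1 f1 + Q f1 f2   ≈⟨ L.a11+a12 ⟩
      Q f2 f2             ∎

  -- Case with τ: if g and h intertwine p, q, r with pᵀ, rᵀ, qᵀ, then g and h
  -- have two other shapes; a matrix having both is a multiple of n.

  n : SM
  n = rows O O P  O P N  P N O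

  record LeftShapeτ (A : Mat) : Set ℓ where
    field
      a00 : A f0 f0 ≈ 0#
      a01 : A f0 f1 ≈ 0#
      a02 : A f0 f2 ≈ A f1 f1 - A f2 f2
      a12 : A f1 f2 ≈ - A f1 f1
      a20 : A f2 f0 ≈ A f1 f1
      a21 : A f2 f1 ≈ - A f1 f1

  record RightShapeτ (B : Mat) : Set ℓ where
    field
      b10 : B f1 f0 ≈ 0#
      b22 : B f2 f2 ≈ B f1 f1 - B f2 f0

  shapesτ : ∀ {A B} → Intertwines A B p (trₛ p) → Intertwines A B q (trₛ r) → Intertwines A B r (trₛ q) →
            LeftShapeτ A × RightShapeτ B
  shapesτ {A} {B} Hp Hq Hr = left , right
    where
    module Hp = Intertwines Hp
    module Hq = Intertwines Hq
    module Hr = Intertwines Hr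
    a01 = cancel0 Hr.scale-unit (Hr.entry f0 f0)
    a21 : A f2 f1 ≈ - A f1 f1
    a21 = inverseʳ-unique _ _ (sum-vanishes Hr.scale-unit (Hr.entry f1 f0) (Hr.entry f2 f0)
            (solve 2 (λ x y → (x :+ y) :+ (:- x :+ :- y) := con (0 , 0)) refl (B f1 f0) (B f2 f0)))
    b11+b12 : B f1 f1 + B f1 f2 ≈ 0#
    b11+b12 = sum-vanishes′ (Hq.entry f0 f1) (Hq.entry f0 f2)
                (solve 2 (λ x y → (x :+ y) :+ (:- x :+ :- y) := con (0 , 0)) refl (A f0 f1) (A f0 f2))
    b10 = scaled-zero (Hq.entry f0 f0)
    left : LeftShapeτ A
    left = record
      { a00 = cancel0 Hp.scale-unit (Hp.entry f0 f1)
      ; a01 = a01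
      ; a02 = begin
          A f0 f2                          ≈⟨ inverseˡ-unique _ _ (begin
              A f0 f2 + (- A f1 f1 + A f2 f2)       ≈⟨ sym (+-congʳ (+-identityˡ _)) ⟩
              (0# + A f0 f2) + (- A f1 f1 + A f2 f2) ≈⟨ +-cong (+-congʳ (sym a01)) (+-congʳ (sym a21)) ⟩
              (A f0 f1 + A f0 f2) + (A f2 f1 + A f2 f2)
                ≈⟨ sum-vanishes Hq.scale-unit (Hq.entry f0 f1) (Hq.entry f2 f1) (-‿inverseʳ (B f1 f1)) ⟩
              0#                                    ∎) ⟩
          - (- A f1 f1 + A f2 f2)          ≈⟨ solve 2 (λ x y → :- (:- x :+ y) := x :+ :- y) refl (A f1 f1) (A f2 f2) ⟩
          A f1 f1 - A f2 f2                ∎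
      ; a12 = inverseʳ-unique _ _ (cancel0 Hq.scale-unit (Hq.entry f1 f1))
      ; a20 = begin
          A f2 f0     ≈⟨ inverseʳ-unique _ _ (trans (+-comm _ _)
                           (sum-vanishes Hp.scale-unit (Hp.entry f2 f1) (Hp.entry f2 f2) b11+b12)) ⟩
          - A f2 f1   ≈⟨ -‿cong a21 ⟩
          - - A f1 f1 ≈⟨ -‿involutive _ ⟩
          A f1 f1     ∎
      ; a21 = a21 }
    right : RightShapeτ B
    right = record
      { b10 = b10
      ; b22 = begin
          B f2 f2       ≈⟨ inverseˡ-unique _ _ (begin
              B f2 f2 + (B f2 f0 - B f1 f1)          ≈⟨ solve 3 (λ x y z → x :+ (y :+ :- z) := (con (0 , 0) :+ y) :+ (:- z :+ x)) refl (B f2 f2) (B f2 f0) (B f1 f1) ⟩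
              (0# + B f2 f0) + (- B f1 f1 + B f2 f2)  ≈⟨ +-cong (+-congʳ (sym b10)) (+-congʳ (sym (inverseʳ-unique _ _ b11+b12))) ⟩
              (B f1 f0 + B f2 f0) + (B f1 f2 + B f2 f2)
                ≈⟨ sum-vanishes′ (Hr.entry f1 f0) (Hr.entry f1 f2) (-‿inverseʳ (A f1 f1)) ⟩
              0#                                      ∎) ⟩
          - (B f2 f0 - B f1 f1) ≈⟨ solve 2 (λ x y → :- (x :+ :- y) := y :+ :- x) refl (B f2 f0) (B f1 f1) ⟩
          B f1 f1 - B f2 f0     ∎ }

  both-shapesτ⇒multiple-of-n : ∀ {Q} → LeftShapeτ Q → RightShapeτ Q → Q ≈M (Q f1 f1 ⋆ ⟪ n ⟫)
  both-shapesτ⇒multiple-of-n {Q} L R = λ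
    { f0 f0 → vanishing L.a00 ; f0 f1 → vanishing L.a01 ; f0 f2 → trans q02≈q11 (sym (*-identityʳ _))
    ; f1 f0 → vanishing R.b10 ; f1 f1 → sym (*-identityʳ _) ; f1 f2 → trans L.a12 minus
    ; f2 f0 → trans L.a20 (sym (*-identityʳ _)) ; f2 f1 → trans L.a21 minus ; f2 f2 → vanishing q22≈0 }
    where
    module L = LeftShapeτ L
    module R = RightShapeτ R
    vanishing : ∀ {x} → x ≈ 0# → x ≈ Q f1 f1 * 0#
    vanishing x≈0 = trans x≈0 (sym (zeroʳ _))
    minus : - Q f1 f1 ≈ Q f1 f1 * - 1#
    minus = solve 1 (λ x → :- x := x :* con (0 , 1)) refl (Q f1 f1)
    q22≈0 : Q f2 f2 ≈ 0#
    q22≈0 = begin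
      Q f2 f2            ≈⟨ R.b22 ⟩
      Q f1 f1 - Q f2 f0  ≈⟨ +-congˡ (-‿cong L.a20) ⟩
      Q f1 f1 - Q f1 f1  ≈⟨ -‿inverseʳ _ ⟩
      0#                 ∎
    q02≈q11 : Q f0 f2 ≈ Q f1 f1
    q02≈q11 = begin
      Q f0 f2            ≈⟨ L.a02 ⟩
      Q f1 f1 - Q f2 f2  ≈⟨ +-congˡ (-‿cong q22≈0) ⟩
      Q f1 f1 - 0#       ≈⟨ solve 1 (λ x → x :+ :- con (0 , 0) := x) refl (Q f1 f1) ⟩
      Q f1 f1            ∎

  IsScalar : GL → Set (c ⊔ ℓ)
  IsScalar g = Σ Carrier λ a → GL.mat g ≈M (a ⋆ idM)

  inverse-of-scalar : ∀ g a → GL.mat g ≈M (a ⋆ idM) → Σ Carrier λ a' → (GL.inv g ≈M (a' ⋆ idM)) × (a * a' ≈ 1#)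
  inverse-of-scalar g a G≈aI = a' , g⁻¹≈a'I , aa'≈1
    where
    a' = GL.inv g f0 f0
    a·g⁻¹≈I : ∀ i j → a * GL.inv g i j ≈ idM i j
    a·g⁻¹≈I i j = trans (sym (≈M-trans (·-multipleʳ (GL.inv g) a idM G≈aI) (⋆-cong a (·-idʳ (GL.inv g))) i j)) (GL.inv-l g i j)
    aa'≈1 = a·g⁻¹≈I f0 f0
    g⁻¹≈a'I : GL.inv g ≈M (a' ⋆ idM)
    g⁻¹≈a'I i j = cancel (a' , aa'≈1) (begin
      a * GL.inv g i j     ≈⟨ a·g⁻¹≈I i j ⟩
      idM i j              ≈⟨ sym (*-identityˡ _) ⟩
      1# * idM i j         ≈⟨ *-congʳ (sym aa'≈1) ⟩
      (a * a') * idM i j   ≈⟨ *-assoc _ _ _ ⟩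
      a * (a' * idM i j)   ∎)

  scalar-sandwich : ∀ g h k → IsScalar g → IsScalar h → IsScalar k → ∀ t → ⟦ sandwich g h k t ⟧ ≈T ⟦ t ⟧
  scalar-sandwich g h k (a , G≈aI) (b , H≈bI) (c′ , K≈cI) (x , y , z) i j d e' f g′ = begin
    ((G · x) · GL.inv h) i j * ((H · y) · GL.inv k) d e' * ((K · z) · GL.inv g) f g′
      ≈⟨ *-cong (*-cong (conj G≈aI h⁻¹≈ x i j) (conj H≈bI k⁻¹≈ y d e')) (conj K≈cI g⁻¹≈ z f g′) ⟩
    (b' * (a * x i j)) * (c' * (b * y d e')) * (a' * (c′ * z f g′))
      ≈⟨ solve 9 (λ a b c a' b' c' x y z → (b' :* (a :* x)) :* (c' :* (b :* y)) :* (a' :* (c :* z))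
                                        := ((a :* a') :* ((b :* b') :* (c :* c'))) :* (x :* y :* z))
                 refl a b c′ a' b' c' (x i j) (y d e') (z f g′) ⟩
    ((a * a') * ((b * b') * (c′ * c'))) * (x i j * y d e' * z f g′)
      ≈⟨ *-congʳ (trans (*-cong aa'≈1 (*-cong bb'≈1 cc'≈1)) (trans (*-identityˡ _) (*-identityˡ _))) ⟩
    1# * (x i j * y d e' * z f g′) ≈⟨ *-identityˡ _ ⟩
    x i j * y d e' * z f g′ ∎
    where
    G = GL.mat g
    H = GL.mat h
    K = GL.mat k
    inv-g = inverse-of-scalar g a G≈aI
    inv-h = inverse-of-scalar h b H≈bI
    inv-k = inverse-of-scalar k c′ K≈cI
    a' = proj₁ inv-g
    b' = proj₁ inv-h
    c' = proj₁ inv-k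
    g⁻¹≈ = proj₁ (proj₂ inv-g)
    h⁻¹≈ = proj₁ (proj₂ inv-h)
    k⁻¹≈ = proj₁ (proj₂ inv-k)
    aa'≈1 = proj₂ (proj₂ inv-g)
    bb'≈1 = proj₂ (proj₂ inv-h)
    cc'≈1 = proj₂ (proj₂ inv-k)
    conj : ∀ {A B α β} → A ≈M (α ⋆ idM) → B ≈M (β ⋆ idM) → ∀ X → ((A · X) · B) ≈M (β ⋆ (α ⋆ X))
    conj {A} {B} {α} {β} A≈ B≈ X =
      ≈M-trans (·-congˡ B (≈M-trans (·-multipleˡ α idM X A≈) (⋆-cong α (·-idˡ X))))
               (≈M-trans (·-multipleʳ (α ⋆ X) β idM B≈) (⋆-cong β (·-idʳ (α ⋆ X))))

  -- Sandwiches by multiples of n: the supports of n x and y n must agree.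

  -- sums and dot products of sign vectors, as long as they stay signs
  _+ₛ_ : E → E → Maybe E
  O +ₛ b = just b
  P +ₛ O = just P
  P +ₛ P = nothing
  P +ₛ N = just O
  N +ₛ O = just N
  N +ₛ P = just O
  N +ₛ N = nothing

  +ₛ-sound : ∀ a b {v} → a +ₛ b ≡ just v → e a + e b ≈ e v
  +ₛ-sound O b ≡.refl = +-identityˡ _
  +ₛ-sound P O ≡.refl = +-identityʳ _
  +ₛ-sound P N ≡.refl = -‿inverseʳ _
  +ₛ-sound N O ≡.refl = +-identityʳ _
  +ₛ-sound N P ≡.refl = -‿inverseˡ _

  dotₛ : (Fin 3 → E) → (Fin 3 → E) → Maybe E
  dotₛ s t = ((s f1 *ₛ t f1) +ₛ (s f2 *ₛ t f2)) >>= ((s f0 *ₛ t f0) +ₛ_)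

  dotₛ-sound : ∀ s t {v} → dotₛ s t ≡ just v →
               e (s f0) * e (t f0) + (e (s f1) * e (t f1) + e (s f2) * e (t f2)) ≈ e v
  dotₛ-sound s t {v} eq with (s f1 *ₛ t f1) +ₛ (s f2 *ₛ t f2) in eq₁
  ... | just u = begin
    e (s f0) * e (t f0) + (e (s f1) * e (t f1) + e (s f2) * e (t f2))
      ≈⟨ +-cong (e-* (s f0) (t f0)) (+-cong (e-* (s f1) (t f1)) (e-* (s f2) (t f2))) ⟩
    e (s f0 *ₛ t f0) + (e (s f1 *ₛ t f1) + e (s f2 *ₛ t f2)) ≈⟨ +-congˡ (+ₛ-sound _ _ eq₁) ⟩
    e (s f0 *ₛ t f0) + e u                                  ≈⟨ +ₛ-sound _ _ eq ⟩
    e v ∎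

  Nonvanishing : Maybe E → Set
  Nonvanishing m = m ≡ just P ⊎ m ≡ just N

  value-of : ∀ {m} → Nonvanishing m → E
  value-of (inj₁ _) = P
  value-of (inj₂ _) = N

  value-of-nonzero : ∀ {m} (nv : Nonvanishing m) → value-of nv ≢ O
  value-of-nonzero (inj₁ _) ()
  value-of-nonzero (inj₂ _) ()

  value-of-correct : ∀ {m} (nv : Nonvanishing m) → m ≡ just (value-of nv)
  value-of-correct (inj₁ m≡P) = m≡P
  value-of-correct (inj₂ m≡N) = m≡N

  Differ : Maybe E → Maybe E → Set
  Differ u w = (u ≡ just O × Nonvanishing w) ⊎ (Nonvanishing u × w ≡ just O)

  Clash : SM → SM → Set
  Clash x y = ∃ λ i → ∃ λ j → Differ (dotₛ (n i) (λ l → x l j)) (dotₛ (y i) (λ l → n l j))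

  clash? : ∀ x y → Dec (Clash x y)
  clash? x y = any? λ i → any? λ j → differ? (dotₛ (n i) (λ l → x l j)) (dotₛ (y i) (λ l → n l j))
    where
    _≟ₘ_ : (u w : Maybe E) → Dec (u ≡ w)
    _≟ₘ_ = Maybe.≡-dec _≟ₛ_
    nonvanishing? : ∀ m → Dec (Nonvanishing m)
    nonvanishing? m = (m ≟ₘ just P) ⊎-dec (m ≟ₘ just N)
    differ? : ∀ u w → Dec (Differ u w)
    differ? u w = ((u ≟ₘ just O) ×-dec nonvanishing? w) ⊎-dec (nonvanishing? u ×-dec (w ≟ₘ just O))

  MultipleOfN : GL → Set (c ⊔ ℓ)
  MultipleOfN g = Σ Carrier λ a → IsUnit a × (GL.mat g ≈M (a ⋆ ⟪ n ⟫))

  -- if g ≈ a n and h ≈ b n intertwine x and y, then  k a (n x) = b (y n)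
  -- with units k, a, b, so n x and y n have the same support
  no-clash : ∀ {g h x y} → MultipleOfN g → MultipleOfN h → Intertwines (GL.mat g) (GL.mat h) x y → ¬ Clash x y
  no-clash {g} {h} {x} {y} (a , a-unit , G≈an) (b , b-unit , H≈bn) I (i , j , differ) = absurd differ
    where
    open Intertwines I renaming (scale to k; scale-unit to k-unit)
    nx = (⟪ n ⟫ · ⟪ x ⟫) i j
    yn = (⟪ y ⟫ · ⟪ n ⟫) i j

    supports : k * (a * nx) ≈ b * yn
    supports = begin
      k * (a * nx)                 ≈⟨ *-congˡ (sym (·-multipleˡ a ⟪ n ⟫ ⟪ x ⟫ G≈an i j)) ⟩
      k * (GL.mat g · ⟪ x ⟫) i j   ≈⟨ equation i j ⟩
      (⟪ y ⟫ · GL.mat h) i j       ≈⟨ ·-multipleʳ ⟪ y ⟫ b ⟪ n ⟫ H≈bn i j ⟩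
      b * yn                       ∎

    absurd : ¬ Differ (dotₛ (n i) (λ l → x l j)) (dotₛ (y i) (λ l → n l j))
    absurd (inj₁ (nx≡0 , yn≢0)) = unit≉0 (unit-* b-unit (e-unit (value-of-nonzero yn≢0))) (begin
      b * e (value-of yn≢0)  ≈⟨ *-congˡ (sym (dotₛ-sound (y i) (λ l → n l j) (value-of-correct yn≢0))) ⟩
      b * yn                 ≈⟨ sym supports ⟩
      k * (a * nx)           ≈⟨ *-congˡ (*-congˡ (dotₛ-sound (n i) (λ l → x l j) nx≡0)) ⟩
      k * (a * 0#)           ≈⟨ trans (*-congˡ (zeroʳ a)) (zeroʳ k) ⟩
      0#                     ∎)
    absurd (inj₂ (nx≢0 , yn≡0)) = unit≉0 (unit-* k-unit (unit-* a-unit (e-unit (value-of-nonzero nx≢0)))) (begin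
      k * (a * e (value-of nx≢0)) ≈⟨ *-congˡ (*-congˡ (sym (dotₛ-sound (n i) (λ l → x l j) (value-of-correct nx≢0)))) ⟩
      k * (a * nx)                ≈⟨ supports ⟩
      b * yn                      ≈⟨ *-congˡ (dotₛ-sound (y i) (λ l → n l j) yn≡0) ⟩
      b * 0#                      ≈⟨ zeroʳ b ⟩
      0#                          ∎)

  FixesCycle : GL → GL → GL → Set ℓ
  FixesCycle g h k = Maps g h k (p , q , r) (p , q , r) × Maps g h k (q , r , p) (q , r , p)
                   × Maps g h k (r , p , q) (r , p , q)

  FixesCycle-rotate : ∀ {g h k} → FixesCycle g h k → FixesCycle h k g
  FixesCycle-rotate (m₂ , m₃ , m₄) = Maps-rotate m₄ , Maps-rotate m₂ , Maps-rotate m₃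

  -- g has the left shape, by (g, h, k), and the right shape, by (k, g, h)
  fixes⇒scalar : ∀ {g h k} → FixesCycle g h k → IsScalar g
  fixes⇒scalar {g} fix = _ , both-shapes⇒scalar (proj₁ (shapes-of fix)) (proj₂ (shapes-of (FixesCycle-rotate (FixesCycle-rotate fix))))
    where
    shapes-of : ∀ {g h k} → FixesCycle g h k → LeftShape (GL.mat g) × RightShape (GL.mat h)
    shapes-of (m₂ , m₃ , m₄) = shapes (intertwines m₂ (pivots (# 2))) (intertwines m₃ (pivots (# 3))) (intertwines m₄ (pivots (# 4)))

  fixes⇒trivial : ∀ {g h k} → FixesCycle g h k → ∀ t → ⟦ sandwich g h k t ⟧ ≈T ⟦ t ⟧
  fixes⇒trivial {g} {h} {k} fix = scalar-sandwich g h k (fixes⇒scalar fix) (fixes⇒scalar rotated) (fixes⇒scalar (FixesCycle-rotate rotated))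
    where rotated = FixesCycle-rotate fix

  FlipsCycle : GL → GL → GL → Set ℓ
  FlipsCycle g h k = Maps g h k (p , q , r) (τₛ (p , q , r)) × Maps g h k (q , r , p) (τₛ (r , p , q))
                   × Maps g h k (r , p , q) (τₛ (q , r , p))

  FlipsCycle-rotate : ∀ {g h k} → FlipsCycle g h k → FlipsCycle h k g
  FlipsCycle-rotate (m₂ , m₃ , m₄) = Maps-rotate m₄ , Maps-rotate m₂ , Maps-rotate m₃

  flips⇒multiple-of-n : ∀ {g h k} → FlipsCycle g h k → MultipleOfN g
  flips⇒multiple-of-n {g} flip = G f1 f1 , G₁₁-unit , G≈G₁₁n
    where
    G = GL.mat g
    shapes-of : ∀ {g h k} → FlipsCycle g h k → LeftShapeτ (GL.mat g) × RightShapeτ (GL.mat h)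
    shapes-of (m₂ , m₃ , m₄) = shapesτ (intertwines m₂ (pivots-τ true (pivots (# 2))))
                                       (intertwines m₃ (pivots-τ true (pivots (# 4))))
                                       (intertwines m₄ (pivots-τ true (pivots (# 3))))
    G≈G₁₁n = both-shapesτ⇒multiple-of-n (proj₁ (shapes-of flip)) (proj₂ (shapes-of (FlipsCycle-rotate (FlipsCycle-rotate flip))))
    -- g is invertible, so the factor G₁₁ is a unit
    G₁₁-unit : IsUnit (G f1 f1)
    G₁₁-unit = (⟪ n ⟫ · GL.inv g) f0 f0 , trans (sym (·-multipleˡ (G f1 f1) ⟪ n ⟫ (GL.inv g) G≈G₁₁n f0 f0)) (GL.inv-r g f0 f0)

  opaque
    S₅-clashes : ∀ j → Clash (proj₁ (Sₛ (# 5))) (proj₁ (τₛ (Sₛ j)))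
                     ⊎ Clash (proj₁ (proj₂ (Sₛ (# 5)))) (proj₁ (proj₂ (τₛ (Sₛ j))))
    S₅-clashes = from-yes (all? λ j → clash? (proj₁ (Sₛ (# 5))) (proj₁ (τₛ (Sₛ j)))
                                     ⊎-dec clash? (proj₁ (proj₂ (Sₛ (# 5)))) (proj₁ (proj₂ (τₛ (Sₛ j)))))

  no-image-of-S₅ : ∀ {g h k} → FlipsCycle g h k → ∀ j → ¬ Maps g h k (Sₛ (# 5)) (τₛ (Sₛ j))
  no-image-of-S₅ {g} {h} {k} flip j m =
    [ no-clash {g} {h} n-g n-h (intertwines m target-pivots)
    , no-clash {h} {k} n-h n-k (intertwines (Maps-rotate m) (pivots-σ target-pivots)) ] (S₅-clashes j)
    where
    target-pivots = pivots-τ true (pivots j)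
    n-g = flips⇒multiple-of-n flip
    n-h = flips⇒multiple-of-n (FlipsCycle-rotate flip)
    n-k = flips⇒multiple-of-n (FlipsCycle-rotate (FlipsCycle-rotate flip))

  σ^-permutes : ∀ a i → ∃ λ j → ⟦ σ^ a (S2fix i) ⟧ ≈T ⟦ S2fix j ⟧
  σ^-permutes a i = j , from-signs j (proj₂ (closed false a i))
    where
    j = proj₁ (closed false a i)
    from-signs : ∀ j → σₛ^ a (Sₛ i) ≐ₜ Sₛ j → ⟦ σ^ a (S2fix i) ⟧ ≈T ⟦ S2fix j ⟧
    from-signs j σᵃSᵢ≐Sⱼ = transport {t' = ⟪ Sₛ j ⟫ₜ} (≡.trans (≡.cong (σ^ a) (S2fix-signs i)) (σ^-⟪⟫ a (Sₛ i)))
                               (S2fix-signs j) (≐ₜ⇒≈T (σₛ^ a (Sₛ i)) (Sₛ j) σᵃSᵢ≐Sⱼ)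

  backward : ∀ γ → (∃ λ a → act γ ≈G σ^ a) → InΓ γ
  backward γ (a , γ≈σᵃ) = image , preimage
    where
    image : ∀ i → ∃ λ j → ⟦ act γ (S2fix i) ⟧ ≈T ⟦ S2fix j ⟧
    image i = proj₁ (σ^-permutes a i) , ≈T-trans (γ≈σᵃ (S2fix i)) (proj₂ (σ^-permutes a i))

    preimage : ∀ j → ∃ λ i → ⟦ act γ (S2fix i) ⟧ ≈T ⟦ S2fix j ⟧
    preimage j = i , ≈T-trans (γ≈σᵃ (S2fix i)) σᵃSᵢ≈Sⱼ
      where
      i = proj₁ (σ^-permutes (- a ₐ) j)
      σᵃSᵢ≈Sⱼ : ⟦ σ^ a (S2fix i) ⟧ ≈T ⟦ S2fix j ⟧
      σᵃSᵢ≈Sⱼ = transport ≡.refl (≡.sym (σ^-section a (S2fix j)))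
                  (σ^-cong a (≈T-sym (proj₂ (σ^-permutes (- a ₐ) j))))

  Moves : GL → GL → GL → Bool → Set ℓ
  Moves g h k b = ∀ i → ∃ λ j → Maps g h k (Sₛ i) (τₛ^ b (Sₛ j))

  moves : ∀ {g h k} a b → (∀ i → ∃ λ j → ⟦ act (elem g h k a b) (S2fix i) ⟧ ≈T ⟦ S2fix j ⟧) → Moves g h k b
  moves {g} {h} {k} a b image i = j' , maps (≈T-trans unwound (≐ₜ⇒≈T _ (τₛ^ b (Sₛ j')) (proj₂ summand)))
    where
    j = proj₁ (image i)
    summand = closed b (- a ₐ) j
    j' = proj₁ summand
    unwound : ⟦ sandwich g h k ⟪ Sₛ i ⟫ₜ ⟧ ≈T ⟦ ⟪ σₛ^ (- a ₐ) (τₛ^ b (Sₛ j)) ⟫ₜ ⟧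
    unwound = transport (≡.cong (sandwich g h k) (≡.sym (S2fix-signs i)))
                (≡.sym (≡.trans (≡.cong (σ^ (- a ₐ)) (≡.trans (≡.cong (τ^ b) (S2fix-signs j)) (τ^-⟪⟫ b (Sₛ j))))
                                (σ^-⟪⟫ (- a ₐ) (τₛ^ b (Sₛ j)))))
                (unwind g h k a b (S2fix i) (S2fix j) (proj₂ (image i)))

  forced : ∀ {g h k} b → Moves g h k b → ∀ i i' → UniqueProfile b i i' → Maps g h k (Sₛ i) (τₛ^ b (Sₛ i'))
  forced {g} {h} {k} b mv i i' unique =
    ≡.subst (λ j → Maps g h k (Sₛ i) (τₛ^ b (Sₛ j)))
      (unique j (≡.sym (profile-invariant (Sₛ i) (τₛ^ b (Sₛ j)) (proj₂ (mv i)) (pivots-τ b (pivots j)))))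
      (proj₂ (mv i))
    where j = proj₁ (mv i)

  forward : ∀ γ → InΓ γ → ∃ λ a → act γ ≈G σ^ a
  forward (elem g h k a false) (image , _) = a , λ t → σ^-cong a (fixes⇒trivial fixes t)
    where
    mv = moves a false image
    fixes : FixesCycle g h k
    fixes = forced false mv (# 2) (# 2) (unique-profile₂ false) , forced false mv (# 3) (# 3) (unique-profile₃ false)
          , forced false mv (# 4) (# 4) (unique-profile₄ false)
  forward (elem g h k a true) (image , _) = ⊥-elim (no-image-of-S₅ flips (proj₁ (mv (# 5))) (proj₂ (mv (# 5))))
    where
    mv = moves a true image
    flips : FlipsCycle g h k
    flips = forced true mv (# 2) (# 2) (unique-profile₂ true) , forced true mv (# 3) (# 4) (unique-profile₃ true)
          , forced true mv (# 4) (# 3) (unique-profile₄ true)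

proposition5p4 : ∀ {c ℓ} (F : ACF0 c ℓ) (γ : Over.Elem (ACF0.cring F)) →
  Over.InΓ (ACF0.cring F) γ
    ⇔ (∃ λ (j : Fin 3) → Over._≈G_ (ACF0.cring F) (Over.act (ACF0.cring F) γ) (Over.σ^ (ACF0.cring F) j))
proposition5p4 F γ = mk⇔ (forward γ) (backward γ)
  where open Proof F
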